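{- Let $\lambda$ be a partition of rank $\rho$, let $R=\mathbb{Z}[x_{ij}\colon (i,j)\in\lambda]$, and let $M(1,1)$ be the $(\rho+1)\times(\rho+1)$ matrix $(P_{rs})_{1\le r,s\le \rho+1}$ over $R$. Then there are an upper unitriangular matrix $P$ and a lower unitriangular matrix $Q$ in $\mathrm{SL}(\rho+1,R)$ such that $$P\cdot M(1,1)\cdot Q=\mathrm{diag}(A_{11},A_{22},\dots,A_{\rho+1,\rho+1}).$$ In particular, $\det M(1,1)=A_{11}A_{22}\cdots A_{\rho\rho}$ (since $A_{\rho+1,\rho+1}=1$).
   Context: A partition $\lambda=(\lambda_1\ge\lambda_2\ge\dots\ge\lambda_\ell>0)$ is identified with its Young diagram $\{(r,s)\colon 1\le r\le \ell,\ 1\le s\le\lambda_r\}$, where $(r,s)$ is the square in row $r$ and column $s$. The rank $\rho$ of $\lambda$ is the number of squares on its main diagonal, i.e. the largest $k$ with $\lambda_k\ge k$ ($\rho=0$ if $\lambda=\emptyset$). The extended partition $\lambda^*$ is obtained by adjoining to $\lambda$ the border strip from the end of the first row to the end of the first column; explicitly $\lambda^*$ is the diagram of the partition with parts $\lambda^*_1=\lambda_1+1$ and $\lambda^*_r=\lambda_{r-1}+1$ for $2\le r\le \ell+1$ (so $\emptyset^*=(1)$). Associate to each square $(i,j)\in\lambda$ an indeterminate $x_{ij}$. For $(r,s)\in\lambda^*$ let $\lambda(r,s)$ be the partition whose diagram consists of all squares $(u,v)\in\lambda$ with $u\ge r$, $v\ge s$ (so $\lambda(r,s)=\emptyset$ if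 $(r,s)\in\lambda^*\setminus\lambda$). Define $$P_{rs}=\sum_{\mu\subseteq\lambda(r,s)}\ \prod_{(i,j)\in\lambda(r,s)\setminus\mu}x_{ij},$$ the sum over all partitions $\mu$ whose diagram is contained in $\lambda(r,s)$ (so $P_{rs}=1$ for $(r,s)\in\lambda^*\setminus\lambda$), and $A_{rs}=\prod_{(i,j)\in\lambda(r,s)}x_{ij}$ (empty product $=1$). The square $\{(r,s)\colon 1\le r,s\le\rho+1\}$ lies in $\lambda^*$. -}

module Defs where

open import Level using (Level)
open import Data.Nat using (ℕ; zero; suc; _∸_; _≤_; _≥_; _<_; _<ᵇ_)
open import Data.Nat.Properties using (_≤?_)
open import Data.Bool using (Bool; true; false; _∧_; not)
open import Data.List using (List; []; _∷_; length; map; upTo; concatMap; filter; replicate; foldr)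
open import Data.List.Relation.Unary.All using (All)
open import Data.List.Relation.Unary.Linked using (Linked)
open import Data.Fin using (Fin; toℕ; _≟_)
open import Data.Product using (_×_)
open import Relation.Nullary using (yes; no)
open import Algebra.Bundles using (CommutativeRing)

IsPartition : List ℕ → Set
IsPartition p = Linked _≥_ p × All (λ n → 0 < n) p

-- row λ k = λ_{k+1}  (0-based access, 0 beyond the last part)
row : List ℕ → ℕ → ℕ
row []       _       = 0
row (a ∷ _)  zero    = a
row (_ ∷ as) (suc k) = row as k

-- rank: the number of squares (i,i) on the main diagonal,
-- i.e. the number of i ∈ {1..ℓ} with i ≤ λ_i
rank : List ℕ → ℕ
rank p = length (filter (λ k → suc k ≤? row p k) (upTo (length p)))

-- Region λ(r,s) with r = a+1, s = b+1 (a, b are 0-based offsets).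
-- Its k-th row (0-based, k < ℓ ∸ a) has length λ_{a+k+1} ∸ b; rows of
-- length 0 are kept (they do not change the set of contained partitions
-- nor the set of squares).  Square (k, c) of λ(r,s) (0-based) is the
-- square (a+k+1, b+c+1) of λ.
regionRows : List ℕ → ℕ → ℕ → List ℕ
regionRows p a b = map (λ k → row p (a Data.Nat.+ k) ∸ b) (upTo (length p ∸ a))

bounded : List ℕ → List (List ℕ)
bounded []       = [] ∷ []
bounded (n ∷ ns) = concatMap (λ m → map (m ∷_) (bounded ns)) (upTo (suc n))

decreasingᵇ : List ℕ → Bool
decreasingᵇ []           = true
decreasingᵇ (_ ∷ [])     = true
decreasingᵇ (m ∷ n ∷ ns) = not (m <ᵇ n) ∧ decreasingᵇ (n ∷ ns)

-- the partitions μ ⊆ ν, each written as a length-(length ν) sequence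
-- padded with zeros (this is a bijection with partitions contained in ν)
subpartitions : List ℕ → List (List ℕ)
subpartitions ν = Data.List.filterᵇ decreasingᵇ (bounded ν)

module WithRing {c ℓ : Level} (R : CommutativeRing c ℓ) where
  open CommutativeRing R

  sumL : List Carrier → Carrier
  sumL = foldr _+_ 0#

  prodL : List Carrier → Carrier
  prodL = foldr _*_ 1#

  range : ℕ → ℕ → List ℕ
  range lo hi = map (lo Data.Nat.+_) (upTo (hi ∸ lo))

  -- product of x over the squares of λ(a+1,b+1) lying outside μ
  -- (μ given row by row, 0-based coordinates in the region)
  -- x i j is the indeterminate x_{ij}, 1-based as in the paper.
  skewProd : (ℕ → ℕ → Carrier) → ℕ → ℕ → ℕ → List ℕ → List ℕ → Carrier
  skewProd x a b k []       _        = 1#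
  skewProd x a b k (n ∷ ν) []        =
    prodL (map (λ c → x (suc (a Data.Nat.+ k)) (suc (b Data.Nat.+ c))) (range 0 n))
      * skewProd x a b (suc k) ν []
  skewProd x a b k (n ∷ ν) (m ∷ μ)  =
    prodL (map (λ c → x (suc (a Data.Nat.+ k)) (suc (b Data.Nat.+ c))) (range m n))
      * skewProd x a b (suc k) ν μ

  -- P_{rs} with r = a+1, s = b+1
  Pentry : List ℕ → (ℕ → ℕ → Carrier) → ℕ → ℕ → Carrier
  Pentry p x a b =
    sumL (map (skewProd x a b 0 (regionRows p a b)) (subpartitions (regionRows p a b)))

  -- A_{rs} with r = a+1, s = b+1: product of x over all squares of λ(r,s)
  Aentry : List ℕ → (ℕ → ℕ → Carrier) → ℕ → ℕ → Carrier
  Aentry p x a b = skewProd x a b 0 (regionRows p a b) []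

  Matrix : ℕ → Set c
  Matrix n = Fin n → Fin n → Carrier

  sumFin : (n : ℕ) → (Fin n → Carrier) → Carrier
  sumFin zero    f = 0#
  sumFin (suc n) f = f Data.Fin.zero + sumFin n (λ i → f (Data.Fin.suc i))

  _⊗_ : {n : ℕ} → Matrix n → Matrix n → Matrix n
  _⊗_ {n} M N i j = sumFin n (λ k → M i k * N k j)

  _≋_ : {n : ℕ} → Matrix n → Matrix n → Set ℓ
  M ≋ N = ∀ i j → M i j ≈ N i j

  diag : {n : ℕ} → (Fin n → Carrier) → Matrix n
  diag d i j with i ≟ j
  ... | yes _ = d i
  ... | no  _ = 0#

  UpperUnitriangular : {n : ℕ} → Matrix n → Set ℓ
  UpperUnitriangular {n} P =
    (∀ i → P i i ≈ 1#) × (∀ i j → toℕ j Data.Nat.< toℕ i → P i j ≈ 0#)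

  LowerUnitriangular : {n : ℕ} → Matrix n → Set ℓ
  LowerUnitriangular {n} Q =
    (∀ i → Q i i ≈ 1#) × (∀ i j → toℕ i Data.Nat.< toℕ j → Q i j ≈ 0#)

  M11 : (p : List ℕ) → (ℕ → ℕ → Carrier) → Matrix (suc (rank p))
  M11 p x i j = Pentry p x (toℕ i) (toℕ j)

module Submission where

-- Read a subpartition μ of λ(a+1,b+1) as a weakly decreasing
-- sequence of cuts c_r = b + μ_r, one per row r ≥ a, weighted by the
-- squares of row r right of c_r (module CutSums; ListSums identifies
-- P_{ab} and A_{kk} of Defs with these sums).  Splitting the cut
-- sequences of P_{ab} at the first row k with c_k ≤ k factors each term
-- as U_{ak} · A_{kk} · L_{kb}: the rows a … k−1 (cuts ≥ k) give U_{ak},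
-- the squares of rows ≥ k right of column k give A_{kk}, and the rows
-- ≥ k of λ truncated at column k give L_{kb}.  Terms with k > ρ vanish
-- because row ρ is shorter than ρ+1, so M(1,1) = U · diag(A_{kk}) · L
-- with U upper and L lower unitriangular (module Factorisation).
-- Inverting U and L (module Matrices) gives P = U⁻¹ and Q = L⁻¹.

open import Defs
open import Level using (Level)
open import Function using (_∘_)
open import Data.Bool using (Bool; true; false; _∧_; not; T)
open import Data.Nat using (ℕ; zero; suc; pred; _+_; _∸_; _≤_; _<_; _≥_; _⊓_; _<ᵇ_; _≤′_; ≤′-refl; ≤′-step; z≤n; s≤s)
open import Data.Nat.Properties
  using (_≤?_; _<?_; ≤-refl; ≤-trans; ≤-antisym; ≤-total; ≤-pred; ≤⇒≤′; ≤⇒≯; ≰⇒>; ≮⇒≥; <⇒≤; ≤∧≢⇒<;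
         ≤-<-trans; <-≤-trans; n≮0; n≤1+n; m≤n⇒m≤1+n; m≤m+n; m≤n+m∸n; m+[n∸m]≡n; m+n∸m≡n; n∸n≡0;
         +-∸-comm; ∸-+-assoc; m≤n⇒m∸n≡0; m∸n≡0⇒m≤n; m∸n≤m; ∸-monoˡ-≤; m≤n⇒m⊓n≡m; m≥n⇒m⊓n≡n; m⊓n≤m;
         +-suc; +-monoʳ-≤; +-monoʳ-<; +-mono-≤; +-cancelˡ-≤; m+n≤o⇒m≤o; m+n≤o⇒m≤o∸n; <ᵇ⇒<; <⇒<ᵇ)
import Data.Nat.Properties as ℕ
open import Data.List using (List; []; _∷_; length; map; filter; filterᵇ; upTo; applyUpTo; concatMap; _++_)
open import Data.List.Properties using (map-upTo; map-∘)
open import Data.List.Relation.Unary.Linked using (Linked; []; _∷_)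
open import Data.Fin using (Fin; toℕ; _≟_) renaming (zero to fzero; suc to fsuc)
open import Data.Fin.Properties using (toℕ<n)
open import Data.Product using (Σ; _×_; _,_; proj₁; proj₂)
open import Data.Sum using (inj₁; inj₂)
open import Data.Empty using (⊥-elim)
open import Relation.Nullary using (Dec; yes; no; ¬_)
open import Relation.Nullary.Decidable using (_×-dec_)
open import Relation.Unary using (Decidable)
open import Relation.Binary.PropositionalEquality as ≡ using (_≡_; _≢_)
open import Algebra.Bundles using (CommutativeRing)

module FiniteSums {c ℓ : Level} (R : CommutativeRing c ℓ) where
  open CommutativeRing R renaming (_+_ to _⊕_; _*_ to _⊛_)
  open WithRing R using (sumFin)
  open import Relation.Binary.Reasoning.Setoid setoid
  open import Algebra.Properties.Ring ring using (-‿+-comm; -0#≈0#)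
  open import Algebra.Properties.CommutativeSemigroup +-commutativeSemigroup using () renaming (interchange to +-interchange)

  sumFin-cong : ∀ n {f g : Fin n → Carrier} → (∀ i → f i ≈ g i) → sumFin n f ≈ sumFin n g
  sumFin-cong zero    h = refl
  sumFin-cong (suc n) h = +-cong (h fzero) (sumFin-cong n (h ∘ fsuc))

  sumFin-zero : ∀ n {f : Fin n → Carrier} → (∀ i → f i ≈ 0#) → sumFin n f ≈ 0#
  sumFin-zero zero    h = refl
  sumFin-zero (suc n) h = trans (+-cong (h fzero) (sumFin-zero n (h ∘ fsuc))) (+-identityʳ 0#)

  sumFin-+ : ∀ n (f g : Fin n → Carrier) → sumFin n (λ i → f i ⊕ g i) ≈ sumFin n f ⊕ sumFin n g
  sumFin-+ zero    f g = sym (+-identityʳ 0#)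
  sumFin-+ (suc n) f g = trans (+-congˡ (sumFin-+ n (f ∘ fsuc) (g ∘ fsuc))) (+-interchange _ _ _ _)

  sumFin-neg : ∀ n (f : Fin n → Carrier) → sumFin n (λ i → - f i) ≈ - sumFin n f
  sumFin-neg zero    f = sym -0#≈0#
  sumFin-neg (suc n) f = trans (+-congˡ (sumFin-neg n (f ∘ fsuc))) (-‿+-comm _ _)

  sumFin-*ˡ : ∀ n a (f : Fin n → Carrier) → a ⊛ sumFin n f ≈ sumFin n (λ i → a ⊛ f i)
  sumFin-*ˡ zero    a f = zeroʳ a
  sumFin-*ˡ (suc n) a f = trans (distribˡ a _ _) (+-congˡ (sumFin-*ˡ n a (f ∘ fsuc)))

  sumFin-*ʳ : ∀ n a (f : Fin n → Carrier) → sumFin n f ⊛ a ≈ sumFin n (λ i → f i ⊛ a)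
  sumFin-*ʳ zero    a f = zeroˡ a
  sumFin-*ʳ (suc n) a f = trans (distribʳ a _ _) (+-congˡ (sumFin-*ʳ n a (f ∘ fsuc)))

  sumFin-swap : ∀ n m (f : Fin n → Fin m → Carrier) →
    sumFin n (λ i → sumFin m (f i)) ≈ sumFin m (λ j → sumFin n (λ i → f i j))
  sumFin-swap zero    m f = sym (sumFin-zero m (λ _ → refl))
  sumFin-swap (suc n) m f = begin
    sumFin m (f fzero) ⊕ sumFin n (λ i → sumFin m (f (fsuc i)))
      ≈⟨ +-congˡ (sumFin-swap n m (f ∘ fsuc)) ⟩
    sumFin m (f fzero) ⊕ sumFin m (λ j → sumFin n (λ i → f (fsuc i) j))
      ≈⟨ sumFin-+ m (f fzero) (λ j → sumFin n (λ i → f (fsuc i) j)) ⟨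
    sumFin m (λ j → f fzero j ⊕ sumFin n (λ i → f (fsuc i) j)) ∎

  sumN : (ℕ → Carrier) → ℕ → Carrier
  sumN f zero    = 0#
  sumN f (suc n) = f 0 ⊕ sumN (f ∘ suc) n

  sumFin-toℕ : ∀ n (f : ℕ → Carrier) → sumFin n (f ∘ toℕ) ≈ sumN f n
  sumFin-toℕ zero    f = refl
  sumFin-toℕ (suc n) f = +-congˡ (sumFin-toℕ n (f ∘ suc))

  sumN-cong : ∀ n {f g : ℕ → Carrier} → (∀ i → i < n → f i ≈ g i) → sumN f n ≈ sumN g n
  sumN-cong zero    h = refl
  sumN-cong (suc n) h = +-cong (h 0 (s≤s z≤n)) (sumN-cong n (λ i i<n → h (suc i) (s≤s i<n)))

  sumN-zero : ∀ n {f : ℕ → Carrier} → (∀ i → i < n → f i ≈ 0#) → sumN f n ≈ 0#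
  sumN-zero zero    h = refl
  sumN-zero (suc n) h =
    trans (+-cong (h 0 (s≤s z≤n)) (sumN-zero n (λ i i<n → h (suc i) (s≤s i<n)))) (+-identityʳ 0#)

  sumN-+ : ∀ n (f g : ℕ → Carrier) → sumN (λ i → f i ⊕ g i) n ≈ sumN f n ⊕ sumN g n
  sumN-+ zero    f g = sym (+-identityʳ 0#)
  sumN-+ (suc n) f g = trans (+-congˡ (sumN-+ n (f ∘ suc) (g ∘ suc))) (+-interchange _ _ _ _)

  sumN-*ˡ : ∀ n a (f : ℕ → Carrier) → a ⊛ sumN f n ≈ sumN (λ i → a ⊛ f i) n
  sumN-*ˡ zero    a f = zeroʳ a
  sumN-*ˡ (suc n) a f = trans (distribˡ a _ _) (+-congˡ (sumN-*ˡ n a (f ∘ suc)))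

  sumN-*ʳ : ∀ n a (f : ℕ → Carrier) → sumN f n ⊛ a ≈ sumN (λ i → f i ⊛ a) n
  sumN-*ʳ zero    a f = zeroˡ a
  sumN-*ʳ (suc n) a f = trans (distribʳ a _ _) (+-congˡ (sumN-*ʳ n a (f ∘ suc)))

  sumN-swap : ∀ n m (f : ℕ → ℕ → Carrier) →
    sumN (λ i → sumN (f i) m) n ≈ sumN (λ j → sumN (λ i → f i j) n) m
  sumN-swap zero    m f = sym (sumN-zero m (λ _ _ → refl))
  sumN-swap (suc n) m f = begin
    sumN (f 0) m ⊕ sumN (λ i → sumN (f (suc i)) m) n
      ≈⟨ +-congˡ (sumN-swap n m (f ∘ suc)) ⟩
    sumN (f 0) m ⊕ sumN (λ j → sumN (λ i → f (suc i) j) n) m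
      ≈⟨ sumN-+ m (f 0) (λ j → sumN (λ i → f (suc i) j) n) ⟨
    sumN (λ j → f 0 j ⊕ sumN (λ i → f (suc i) j) n) m ∎

  sumN-split : ∀ p q (f : ℕ → Carrier) → sumN f (p + q) ≈ sumN f p ⊕ sumN (λ i → f (p + i)) q
  sumN-split zero    q f = sym (+-identityˡ _)
  sumN-split (suc p) q f = trans (+-congˡ (sumN-split p q (f ∘ suc))) (sym (+-assoc _ _ _))

  sumN-truncate : ∀ n w (f : ℕ → Carrier) → w ≤ n → (∀ i → w ≤ i → i < n → f i ≈ 0#) →
    sumN f n ≈ sumN f w
  sumN-truncate n w f w≤n vanish = begin
    sumN f n                                   ≡⟨ ≡.cong (sumN f) (≡.sym (m+[n∸m]≡n w≤n)) ⟩
    sumN f (w + (n ∸ w))                       ≈⟨ sumN-split w (n ∸ w) f ⟩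
    sumN f w ⊕ sumN (λ i → f (w + i)) (n ∸ w)  ≈⟨ +-congˡ (sumN-zero (n ∸ w) tail-vanishes) ⟩
    sumN f w ⊕ 0#                              ≈⟨ +-identityʳ _ ⟩
    sumN f w ∎
    where
      tail-vanishes : ∀ i → i < n ∸ w → f (w + i) ≈ 0#
      tail-vanishes i i<n∸w =
        vanish (w + i) (m≤m+n w i) (≡.subst (w + i <_) (m+[n∸m]≡n w≤n) (+-monoʳ-< w i<n∸w))

  sumN-drop : ∀ a w (f : ℕ → Carrier) → (∀ i → i < a → f i ≈ 0#) →
    sumN f (a + w) ≈ sumN (λ i → f (a + i)) w
  sumN-drop a w f vanish = begin
    sumN f (a + w)                              ≈⟨ sumN-split a w f ⟩
    sumN f a ⊕ sumN (λ i → f (a + i)) w         ≈⟨ +-congʳ (sumN-zero a vanish) ⟩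
    0# ⊕ sumN (λ i → f (a + i)) w               ≈⟨ +-identityˡ _ ⟩
    sumN (λ i → f (a + i)) w ∎

  sumN-single : ∀ n k (f : ℕ → Carrier) → k < n → (∀ i → i < n → i ≢ k → f i ≈ 0#) → sumN f n ≈ f k
  sumN-single (suc n) zero f _ h =
    trans (+-congˡ (sumN-zero n (λ i i<n → h (suc i) (s≤s i<n) (λ ())))) (+-identityʳ _)
  sumN-single (suc n) (suc k) f (s≤s k<n) h =
    trans (+-congʳ (h 0 (s≤s z≤n) (λ ())))
      (trans (+-identityˡ _)
        (sumN-single n k (f ∘ suc) k<n (λ i i<n i≢k → h (suc i) (s≤s i<n) (i≢k ∘ ≡.cong pred))))

  prodN : (ℕ → Carrier) → ℕ → Carrier
  prodN f zero    = 1#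
  prodN f (suc n) = f 0 ⊛ prodN (f ∘ suc) n

  ≡⇒≈ : (F : ℕ → Carrier) {a b : ℕ} → a ≡ b → F a ≈ F b
  ≡⇒≈ F e = reflexive (≡.cong F e)

  prodN-cong : ∀ n {f g : ℕ → Carrier} → (∀ i → f i ≈ g i) → prodN f n ≈ prodN g n
  prodN-cong zero    h = refl
  prodN-cong (suc n) h = *-cong (h 0) (prodN-cong n (h ∘ suc))

  prodN-split : ∀ p q (f : ℕ → Carrier) → prodN f (p + q) ≈ prodN f p ⊛ prodN (λ i → f (p + i)) q
  prodN-split zero    q f = sym (*-identityˡ _)
  prodN-split (suc p) q f = trans (*-congˡ (prodN-split p q (f ∘ suc))) (sym (*-assoc _ _ _))

  when : Bool → Carrier → Carrier
  when true  v = v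
  when false v = 0#

  only : {P : Set} → Dec P → Carrier → Carrier
  only (yes _) v = v
  only (no _)  v = 0#

  only-yes : {P : Set} (d : Dec P) {v : Carrier} → P → only d v ≈ v
  only-yes (yes _) _ = refl
  only-yes (no ¬p) p = ⊥-elim (¬p p)

  only-no : {P : Set} (d : Dec P) {v : Carrier} → ¬ P → only d v ≈ 0#
  only-no (yes p) ¬p = ⊥-elim (¬p p)
  only-no (no _)  _  = refl

  only-zero : {P : Set} (d : Dec P) {v : Carrier} → (P → v ≈ 0#) → only d v ≈ 0#
  only-zero (yes p) h = h p
  only-zero (no _)  h = refl

  only-cong : {P : Set} (d : Dec P) {u v : Carrier} → (P → u ≈ v) → only d u ≈ only d v
  only-cong (yes p) h = h p
  only-cong (no _)  h = refl

  only-resp : {P Q : Set} (d : Dec P) (e : Dec Q) {u v : Carrier} →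
    (P → Q) → (Q → P) → (P → u ≈ v) → only d u ≈ only e v
  only-resp (yes p) (yes q) f g h = h p
  only-resp (yes p) (no ¬q) f g h = ⊥-elim (¬q (f p))
  only-resp (no ¬p) (yes q) f g h = ⊥-elim (¬p (g q))
  only-resp (no ¬p) (no ¬q) f g h = refl

  only-*ˡ : {P : Set} (d : Dec P) (a u : Carrier) → a ⊛ only d u ≈ only d (a ⊛ u)
  only-*ˡ (yes _) a u = refl
  only-*ˡ (no _)  a u = zeroʳ a

  only-*ʳ : {P : Set} (d : Dec P) (a u : Carrier) → only d u ⊛ a ≈ only d (u ⊛ a)
  only-*ʳ (yes _) a u = refl
  only-*ʳ (no _)  a u = zeroˡ a

  only-sumN : {P : Set} (d : Dec P) (n : ℕ) (f : ℕ → Carrier) → only d (sumN f n) ≈ sumN (λ j → only d (f j)) n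
  only-sumN (yes _) n f = refl
  only-sumN (no _)  n f = sym (sumN-zero n (λ _ _ → refl))


module Matrices {c ℓ : Level} (R : CommutativeRing c ℓ) where
  open CommutativeRing R renaming (_+_ to _⊕_; _*_ to _⊛_)
  open WithRing R
  open FiniteSums R
  open import Relation.Binary.Reasoning.Setoid setoid
  open import Algebra.Properties.Ring ring using (-‿distribˡ-*)

  I : ∀ {n} → Matrix n
  I fzero    fzero    = 1#
  I fzero    (fsuc _) = 0#
  I (fsuc _) fzero    = 0#
  I (fsuc i) (fsuc j) = I i j

  I-diag : ∀ {n} (i : Fin n) → I i i ≈ 1#
  I-diag fzero    = refl
  I-diag (fsuc i) = I-diag i

  I-off : ∀ {n} (i j : Fin n) → i ≢ j → I i j ≈ 0#
  I-off fzero    fzero    i≢j = ⊥-elim (i≢j ≡.refl)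
  I-off fzero    (fsuc j) _   = refl
  I-off (fsuc i) fzero    _   = refl
  I-off (fsuc i) (fsuc j) i≢j = I-off i j (i≢j ∘ ≡.cong fsuc)

  I-sumˡ : ∀ n (f : Fin n → Carrier) (i : Fin n) → sumFin n (λ k → I i k ⊛ f k) ≈ f i
  I-sumˡ (suc n) f fzero =
    trans (+-cong (*-identityˡ _) (sumFin-zero n (λ k → zeroˡ _))) (+-identityʳ _)
  I-sumˡ (suc n) f (fsuc i) = trans (+-cong (zeroˡ _) (I-sumˡ n (f ∘ fsuc) i)) (+-identityˡ _)

  I-sumʳ : ∀ n (f : Fin n → Carrier) (j : Fin n) → sumFin n (λ k → f k ⊛ I k j) ≈ f j
  I-sumʳ (suc n) f fzero =
    trans (+-cong (*-identityʳ _) (sumFin-zero n (λ k → zeroʳ _))) (+-identityʳ _)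
  I-sumʳ (suc n) f (fsuc j) = trans (+-cong (zeroʳ _) (I-sumʳ n (f ∘ fsuc) j)) (+-identityˡ _)

  I-⊗ : ∀ {n} (M : Matrix n) → (I ⊗ M) ≋ M
  I-⊗ {n} M i j = I-sumˡ n (λ k → M k j) i

  ⊗-I : ∀ {n} (M : Matrix n) → (M ⊗ I) ≋ M
  ⊗-I {n} M i j = I-sumʳ n (M i) j

  ≋-sym : ∀ {n} {M N : Matrix n} → M ≋ N → N ≋ M
  ≋-sym h i j = sym (h i j)

  ≋-trans : ∀ {n} {M N K : Matrix n} → M ≋ N → N ≋ K → M ≋ K
  ≋-trans h h' i j = trans (h i j) (h' i j)

  ⊗-congˡ : ∀ {n} {M M' : Matrix n} (N : Matrix n) → M ≋ M' → (M ⊗ N) ≋ (M' ⊗ N)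
  ⊗-congˡ {n} N h i j = sumFin-cong n (λ k → *-congʳ (h i k))

  ⊗-congʳ : ∀ {n} (M : Matrix n) {N N' : Matrix n} → N ≋ N' → (M ⊗ N) ≋ (M ⊗ N')
  ⊗-congʳ {n} M h i j = sumFin-cong n (λ k → *-congˡ (h k j))

  row-⊗-assoc : ∀ n (u : Fin n → Carrier) (M N : Matrix n) (j : Fin n) →
    sumFin n (λ k → sumFin n (λ m → u m ⊛ M m k) ⊛ N k j) ≈ sumFin n (λ m → u m ⊛ (M ⊗ N) m j)
  row-⊗-assoc n u M N j = begin
    sumFin n (λ k → sumFin n (λ m → u m ⊛ M m k) ⊛ N k j)
      ≈⟨ sumFin-cong n (λ k → sumFin-*ʳ n (N k j) (λ m → u m ⊛ M m k)) ⟩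
    sumFin n (λ k → sumFin n (λ m → (u m ⊛ M m k) ⊛ N k j))
      ≈⟨ sumFin-swap n n _ ⟩
    sumFin n (λ m → sumFin n (λ k → (u m ⊛ M m k) ⊛ N k j))
      ≈⟨ sumFin-cong n (λ m → sumFin-cong n (λ k → *-assoc _ _ _)) ⟩
    sumFin n (λ m → sumFin n (λ k → u m ⊛ (M m k ⊛ N k j)))
      ≈⟨ sumFin-cong n (λ m → sumFin-*ˡ n (u m) _) ⟨
    sumFin n (λ m → u m ⊛ (M ⊗ N) m j) ∎

  ⊗-assoc : ∀ {n} (M N K : Matrix n) → ((M ⊗ N) ⊗ K) ≋ (M ⊗ (N ⊗ K))
  ⊗-assoc {n} M N K i = row-⊗-assoc n (M i) N K

  diag≈scaled-I : ∀ {n} (d : Fin n → Carrier) (i j : Fin n) → diag d i j ≈ d i ⊛ I i j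
  diag≈scaled-I d i j with i ≟ j
  ... | yes ≡.refl = sym (trans (*-congˡ (I-diag i)) (*-identityʳ _))
  ... | no i≢j     = sym (trans (*-congˡ (I-off i j i≢j)) (zeroʳ _))

  diag-⊗ : ∀ {n} (d : Fin n → Carrier) (M : Matrix n) → (diag d ⊗ M) ≋ (λ i j → d i ⊛ M i j)
  diag-⊗ {n} d M i j = begin
    sumFin n (λ k → diag d i k ⊛ M k j)   ≈⟨ sumFin-cong n (λ k → *-congʳ (diag≈scaled-I d i k)) ⟩
    sumFin n (λ k → (d i ⊛ I i k) ⊛ M k j) ≈⟨ sumFin-cong n (λ k → *-assoc _ _ _) ⟩
    sumFin n (λ k → d i ⊛ (I i k ⊛ M k j)) ≈⟨ sumFin-*ˡ n (d i) _ ⟨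
    d i ⊛ sumFin n (λ k → I i k ⊛ M k j)   ≈⟨ *-congˡ (I-sumˡ n (λ k → M k j) i) ⟩
    d i ⊛ M i j ∎

  _ᵀ : ∀ {n} → Matrix n → Matrix n
  (M ᵀ) i j = M j i

  ⊗-ᵀ : ∀ {n} (M N : Matrix n) → ((M ⊗ N) ᵀ) ≋ ((N ᵀ) ⊗ (M ᵀ))
  ⊗-ᵀ {n} M N i j = sumFin-cong n (λ k → *-comm (M j k) (N k i))

  Iᵀ : ∀ {n} → (I {n} ᵀ) ≋ I
  Iᵀ fzero    fzero    = refl
  Iᵀ fzero    (fsuc _) = refl
  Iᵀ (fsuc _) fzero    = refl
  Iᵀ (fsuc i) (fsuc j) = Iᵀ i j

  upperBlock : ∀ {n} → Carrier → (Fin n → Carrier) → Matrix n → Matrix (suc n)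
  upperBlock a r M fzero    fzero    = a
  upperBlock a r M fzero    (fsuc j) = r j
  upperBlock a r M (fsuc i) fzero    = 0#
  upperBlock a r M (fsuc i) (fsuc j) = M i j

  -- An upper unitriangular matrix has an upper unitriangular left inverse.
  -- For U = (1 u; 0 U') take P = (1 -uP'; 0 P') with P' U' = I.
  upper-inverse : ∀ n (U : Matrix n) → UpperUnitriangular U →
    Σ (Matrix n) λ P → UpperUnitriangular P × (P ⊗ U) ≋ I
  upper-inverse zero    U _ = (λ ()) , ((λ ()) , (λ ())) , (λ ())
  upper-inverse (suc n) U (U-diag , U-lower) = P , (P-diag , P-lower) , P⊗U
    where
      U' : Matrix n
      U' i j = U (fsuc i) (fsuc j)
      inner = upper-inverse n U' (U-diag ∘ fsuc , λ i j j<i → U-lower (fsuc i) (fsuc j) (s≤s j<i))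
      P'    = proj₁ inner
      P'U'  = proj₂ (proj₂ inner)
      u : Fin n → Carrier
      u j = U fzero (fsuc j)
      r : Fin n → Carrier
      r j = - sumFin n (λ k → u k ⊛ P' k j)
      P : Matrix (suc n)
      P = upperBlock 1# r P'
      P-diag : ∀ i → P i i ≈ 1#
      P-diag fzero    = refl
      P-diag (fsuc i) = proj₁ (proj₁ (proj₂ inner)) i
      P-lower : ∀ i j → toℕ j < toℕ i → P i j ≈ 0#
      P-lower (fsuc i) fzero    _         = refl
      P-lower (fsuc i) (fsuc j) (s≤s j<i) = proj₂ (proj₁ (proj₂ inner)) i j j<i
      U-col : ∀ k → U (fsuc k) fzero ≈ 0#
      U-col k = U-lower (fsuc k) fzero (s≤s z≤n)
      rU' : ∀ j → sumFin n (λ k → r k ⊛ U' k j) ≈ - u j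
      rU' j = begin
        sumFin n (λ k → r k ⊛ U' k j)
          ≈⟨ sumFin-cong n (λ k → sym (-‿distribˡ-* _ _)) ⟩
        sumFin n (λ k → - (sumFin n (λ m → u m ⊛ P' m k) ⊛ U' k j))
          ≈⟨ sumFin-neg n _ ⟩
        - sumFin n (λ k → sumFin n (λ m → u m ⊛ P' m k) ⊛ U' k j)
          ≈⟨ -‿cong (row-⊗-assoc n u P' U' j) ⟩
        - sumFin n (λ m → u m ⊛ (P' ⊗ U') m j)
          ≈⟨ -‿cong (sumFin-cong n (λ m → *-congˡ (P'U' m j))) ⟩
        - sumFin n (λ m → u m ⊛ I m j)
          ≈⟨ -‿cong (I-sumʳ n u j) ⟩
        - u j ∎
      P⊗U : (P ⊗ U) ≋ I
      P⊗U fzero fzero =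
        trans (+-cong (*-identityˡ _) (sumFin-zero n (λ k → trans (*-congˡ (U-col k)) (zeroʳ _))))
          (trans (+-identityʳ _) (U-diag fzero))
      P⊗U fzero (fsuc j) = trans (+-cong (*-identityˡ _) (rU' j)) (-‿inverseʳ _)
      P⊗U (fsuc i) fzero =
        trans (+-cong (zeroˡ _) (sumFin-zero n (λ k → trans (*-congˡ (U-col k)) (zeroʳ _))))
          (+-identityʳ _)
      P⊗U (fsuc i) (fsuc j) = trans (+-cong (zeroˡ _) (P'U' i j)) (+-identityˡ _)

  -- By transposition, a lower unitriangular matrix has a lower
  -- unitriangular right inverse.
  lower-inverse : ∀ n (L : Matrix n) → LowerUnitriangular L →
    Σ (Matrix n) λ Q → LowerUnitriangular Q × (L ⊗ Q) ≋ I
  lower-inverse n L (L-diag , L-upper) = (P ᵀ) , (P-diag , λ i j i<j → P-lower j i i<j) , L⊗Pᵀ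
    where
      inv = upper-inverse n (L ᵀ) (L-diag , λ i j j<i → L-upper j i j<i)
      P = proj₁ inv
      P-diag = proj₁ (proj₁ (proj₂ inv))
      P-lower = proj₂ (proj₁ (proj₂ inv))
      L⊗Pᵀ : (L ⊗ (P ᵀ)) ≋ I
      L⊗Pᵀ = ≋-trans (≋-sym (⊗-ᵀ P (L ᵀ))) (λ i j → trans (proj₂ (proj₂ inv) j i) (Iᵀ i j))

  diagonalise : ∀ {n} (M U L : Matrix n) (d : Fin n → Carrier) →
    UpperUnitriangular U → LowerUnitriangular L → M ≋ (U ⊗ (diag d ⊗ L)) →
    Σ (Matrix n) λ P → Σ (Matrix n) λ Q →
      UpperUnitriangular P × LowerUnitriangular Q × ((P ⊗ M) ⊗ Q) ≋ diag d
  diagonalise {n} M U L d U-unit L-unit M≋UDL = P , Q , P-unit , Q-unit , PMQ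
    where
      up  = upper-inverse n U U-unit
      low = lower-inverse n L L-unit
      P = proj₁ up
      Q = proj₁ low
      P-unit = proj₁ (proj₂ up)
      Q-unit = proj₁ (proj₂ low)
      D = diag d
      PMQ : ((P ⊗ M) ⊗ Q) ≋ D
      PMQ i j = begin
        ((P ⊗ M) ⊗ Q) i j             ≈⟨ ⊗-congˡ Q (⊗-congʳ P M≋UDL) i j ⟩
        ((P ⊗ (U ⊗ (D ⊗ L))) ⊗ Q) i j ≈⟨ ⊗-congˡ Q (≋-sym (⊗-assoc P U (D ⊗ L))) i j ⟩
        (((P ⊗ U) ⊗ (D ⊗ L)) ⊗ Q) i j ≈⟨ ⊗-congˡ Q (⊗-congˡ (D ⊗ L) (proj₂ (proj₂ up))) i j ⟩
        ((I ⊗ (D ⊗ L)) ⊗ Q) i j       ≈⟨ ⊗-congˡ Q (I-⊗ (D ⊗ L)) i j ⟩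
        ((D ⊗ L) ⊗ Q) i j             ≈⟨ ⊗-assoc D L Q i j ⟩
        (D ⊗ (L ⊗ Q)) i j             ≈⟨ ⊗-congʳ D (proj₂ (proj₂ low)) i j ⟩
        (D ⊗ I) i j                   ≈⟨ ⊗-I D i j ⟩
        D i j ∎


module Partitions where

  row-step : ∀ p → Linked _≥_ p → ∀ i → row p (suc i) ≤ row p i
  row-step []           _          i       = z≤n
  row-step (a ∷ [])     _          i       = z≤n
  row-step (a ∷ b ∷ q) (a≥b ∷ _)  zero    = a≥b
  row-step (a ∷ b ∷ q) (_ ∷ lk)   (suc i) = row-step (b ∷ q) lk i

  row-antitone : ∀ p → Linked _≥_ p → ∀ {i j} → i ≤ j → row p j ≤ row p i
  row-antitone p lk {i} i≤j = go (≤⇒≤′ i≤j)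
    where
      go : ∀ {j} → i ≤′ j → row p j ≤ row p i
      go ≤′-refl      = ≤-refl
      go (≤′-step h)  = ≤-trans (row-step p lk _) (go h)

  row-length : ∀ p → row p (length p) ≡ 0
  row-length []      = ≡.refl
  row-length (_ ∷ p) = row-length p

  module _ {A : Set} {P : A → Set} (P? : Decidable P) where

    prefix-count : ∀ (f : ℕ → A) n → (∀ {i j} → i ≤ j → P (f j) → P (f i)) →
      (∀ i → i < length (filter P? (applyUpTo f n)) → P (f i)) ×
      (length (filter P? (applyUpTo f n)) < n → ¬ P (f (length (filter P? (applyUpTo f n))))) ×
      length (filter P? (applyUpTo f n)) ≤ n
    prefix-count f zero    closed = (λ _ ()) , (λ ()) , z≤n
    prefix-count f (suc n) closed with P? (f 0)
    ... | yes p  = holds′ , (λ r<n → fails (≤-pred r<n)) , s≤s r≤n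
      where
        rest = prefix-count (f ∘ suc) n (λ i≤j → closed (s≤s i≤j))
        holds = proj₁ rest
        fails = proj₁ (proj₂ rest)
        r≤n   = proj₂ (proj₂ rest)
        holds′ : ∀ i → i < suc (length (filter P? (applyUpTo (f ∘ suc) n))) → P (f i)
        holds′ zero    _         = p
        holds′ (suc i) (s≤s i<r) = holds i i<r
    ... | no ¬p  = (λ i i<r → ⊥-elim (n≮0 (≡.subst (i <_) r≡0 i<r)))
                 , (λ _ → ≡.subst (λ r → ¬ P (f r)) (≡.sym r≡0) ¬p)
                 , m≤n⇒m≤1+n (proj₂ (proj₂ rest))
      where
        rest = prefix-count (f ∘ suc) n (λ i≤j → closed (s≤s i≤j))
        -- if P fails at f 0 it fails everywhere, so nothing survives
        run-empty : ∀ r → (∀ i → i < r → P (f (suc i))) → r ≡ 0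
        run-empty zero    _     = ≡.refl
        run-empty (suc r) holds = ⊥-elim (¬p (closed z≤n (holds 0 (s≤s z≤n))))
        r≡0 : length (filter P? (applyUpTo (f ∘ suc) n)) ≡ 0
        r≡0 = run-empty _ (proj₁ rest)

  module Rank (p : List ℕ) (isP : IsPartition p) where

    private
      antitone : ∀ {i j} → i ≤ j → row p j ≤ row p i
      antitone = row-antitone p (proj₁ isP)

      count : (∀ i → i < rank p → suc i ≤ row p i) ×
              (rank p < length p → ¬ suc (rank p) ≤ row p (rank p)) × rank p ≤ length p
      count = prefix-count (λ k → suc k ≤? row p k) (λ k → k) (length p)
                (λ i≤j h → ≤-trans (s≤s i≤j) (≤-trans h (antitone i≤j)))

    rank≤length : rank p ≤ length p
    rank≤length = proj₂ (proj₂ count)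

    diagonal-in : ∀ i → i < rank p → suc i ≤ row p i
    diagonal-in = proj₁ count

    diagonal-out : row p (rank p) ≤ rank p
    diagonal-out with rank p <? length p
    ... | yes ρ<ℓ = ≤-pred (≰⇒> (proj₁ (proj₂ count) ρ<ℓ))
    ... | no  ρ≮ℓ = ≡.subst (_≤ rank p) (≡.sym (≡.trans (≡.cong (row p) ρ≡ℓ) (row-length p))) z≤n
      where
        ρ≡ℓ : rank p ≡ length p
        ρ≡ℓ = ≤-antisym rank≤length (≮⇒≥ ρ≮ℓ)

    square-in : ∀ k → k ≤ rank p → ∀ i → i < k → k ≤ row p i
    square-in (suc k) k<ρ i (s≤s i≤k) = ≤-trans (diagonal-in k k<ρ) (antitone i≤k)


-- A row-length function lam (row u
-- has squares in columns 0 … lam u − 1) is cut in each row u at a column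
-- c_u; the squares of row u right of the cut have weight
-- segment u c_u (lam u).  cutSum adds these weights over the weakly
-- decreasing cut sequences, each cut below the bound B, subject to the
-- bounds of `Admissible`.  With lower bound lo = b these are exactly
-- the sums P_{ab} (see the next module).
module CutSums {c ℓ : Level} (R : CommutativeRing c ℓ)
               (x : ℕ → ℕ → CommutativeRing.Carrier R) (B : ℕ) where
  open CommutativeRing R renaming (_+_ to _⊕_; _*_ to _⊛_)
  open FiniteSums R
  open import Relation.Binary.Reasoning.Setoid setoid
  open import Algebra.Properties.CommutativeSemigroup *-commutativeSemigroup using () renaming (interchange to *-interchange)

  segment : ℕ → ℕ → ℕ → Carrier
  segment u c l = prodN (λ i → x (suc u) (suc (c + i))) (l ∸ c)

  segment-empty : ∀ u c l → l ≤ c → segment u c l ≈ 1#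
  segment-empty u c l l≤c rewrite m≤n⇒m∸n≡0 l≤c = refl

  segment-split : ∀ u c k l → c ≤ k → segment u c l ≈ segment u c (k ⊓ l) ⊛ segment u k l
  segment-split u c k l c≤k with ≤-total l k
  ... | inj₁ l≤k rewrite m≥n⇒m⊓n≡n l≤k = sym (trans (*-congˡ (segment-empty u k l l≤k)) (*-identityʳ _))
  ... | inj₂ k≤l rewrite m≤n⇒m⊓n≡m k≤l = begin
      prodN f (l ∸ c)                                           ≈⟨ ≡⇒≈ (prodN f) lengths ⟩
      prodN f ((k ∸ c) + (l ∸ k))                               ≈⟨ prodN-split (k ∸ c) (l ∸ k) f ⟩
      prodN f (k ∸ c) ⊛ prodN (λ i → f ((k ∸ c) + i)) (l ∸ k)    ≈⟨ *-congˡ (prodN-cong (l ∸ k) columns) ⟩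
      prodN f (k ∸ c) ⊛ segment u k l ∎
    where
      f = λ i → x (suc u) (suc (c + i))
      lengths : l ∸ c ≡ (k ∸ c) + (l ∸ k)
      lengths = ≡.trans (≡.cong (_∸ c) (≡.sym (m+[n∸m]≡n k≤l))) (+-∸-comm (l ∸ k) c≤k)
      columns : ∀ i → f ((k ∸ c) + i) ≈ x (suc u) (suc (k + i))
      columns i = ≡⇒≈ (λ v → x (suc u) (suc v))
                    (≡.trans (≡.sym (ℕ.+-assoc c (k ∸ c) i)) (≡.cong (_+ i) (m+[n∸m]≡n c≤k)))

  -- A cut c in a row of length l is admissible for the lower bounds lo
  -- and kk and the previous cut m when lo ≤ c, kk ≤ c, c ≤ m and c does
  -- not pass the end of the row, unless it sits at lo: c ≤ max lo l,
  -- written lo + (l ∸ lo).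
  Admissible : ℕ → ℕ → ℕ → ℕ → ℕ → Set
  Admissible lo kk l m c = (lo ≤ c) × (kk ≤ c) × (c ≤ lo + (l ∸ lo)) × (c ≤ m)

  admissible? : ∀ lo kk l m c → Dec (Admissible lo kk l m c)
  admissible? lo kk l m c = (lo ≤? c) ×-dec ((kk ≤? c) ×-dec ((c ≤? lo + (l ∸ lo)) ×-dec (c ≤? m)))

  cutSum : (ℕ → ℕ) → (u n lo kk m : ℕ) → Carrier
  cutSum lam u zero    lo kk m = 1#
  cutSum lam u (suc n) lo kk m =
    sumN (λ c → only (admissible? lo kk (lam u) m c)
                     (segment u c (lam u) ⊛ cutSum lam (suc u) n lo kk c)) B

  block : (ℕ → ℕ) → (k u n : ℕ) → Carrier
  block lam k u zero    = 1#
  block lam k u (suc n) = segment u k (lam u) ⊛ block lam k (suc u) n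

  truncate : ℕ → (ℕ → ℕ) → (ℕ → ℕ)
  truncate k lam i = k ⊓ lam i

  private
    end-truncate : ∀ c k l lo → c ≤ k → c ≤ lo + (l ∸ lo) → c ≤ lo + ((k ⊓ l) ∸ lo)
    end-truncate c k l lo c≤k h with ≤-total l k
    ... | inj₁ l≤k rewrite m≥n⇒m⊓n≡n l≤k = h
    ... | inj₂ k≤l rewrite m≤n⇒m⊓n≡m k≤l = ≤-trans c≤k (m≤n+m∸n k lo)

    end-untruncate : ∀ c k l lo → c ≤ k → c ≤ lo + ((k ⊓ l) ∸ lo) → c ≤ lo + (l ∸ lo)
    end-untruncate c k l lo c≤k h with ≤-total l k
    ... | inj₁ l≤k rewrite m≥n⇒m⊓n≡n l≤k = h
    ... | inj₂ k≤l = ≤-trans c≤k (≤-trans k≤l (m≤n+m∸n l lo))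

  -- Factorisation: if all cuts are ≤ k, the squares right of column k
  -- are always included, contributing the factor block lam k u n.
  cutSum-factor : ∀ lam n u lo kk m k → m ≤ k →
    cutSum lam u n lo kk m ≈ block lam k u n ⊛ cutSum (truncate k lam) u n lo kk m
  cutSum-factor lam zero    u lo kk m k m≤k = sym (*-identityˡ _)
  cutSum-factor lam (suc n) u lo kk m k m≤k =
    trans (sumN-cong B (λ c _ → trans (only-resp (admissible? lo kk (lam u) m c) (admissible? lo kk (k ⊓ lam u) m c)
              (λ (a , b , e , c≤m) → a , b , end-truncate c k (lam u) lo (≤-trans c≤m m≤k) e , c≤m)
              (λ (a , b , e , c≤m) → a , b , end-untruncate c k (lam u) lo (≤-trans c≤m m≤k) e , c≤m)
              (λ (_ , _ , _ , c≤m) → summand c (≤-trans c≤m m≤k)))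
            (sym (only-*ˡ (admissible? lo kk (k ⊓ lam u) m c) _ _))))
      (sym (sumN-*ˡ B _ _))
    where
      summand : ∀ c → c ≤ k → segment u c (lam u) ⊛ cutSum lam (suc u) n lo kk c ≈
        (segment u k (lam u) ⊛ block lam k (suc u) n) ⊛
        (segment u c (k ⊓ lam u) ⊛ cutSum (truncate k lam) (suc u) n lo kk c)
      summand c c≤k = trans (*-cong (segment-split u c k (lam u) c≤k) (cutSum-factor lam n (suc u) lo kk c k c≤k))
                        (trans (*-congʳ (*-comm _ _)) (*-interchange _ _ _ _))

  cutSum-empty : ∀ lam n u lo kk m → (∀ c → ¬ Admissible lo kk (lam u) m c) → cutSum lam u (suc n) lo kk m ≈ 0#
  cutSum-empty lam n u lo kk m none = sumN-zero B (λ c _ → only-no (admissible? lo kk (lam u) m c) (none c))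

  -- If the floor kk dominates the lower bounds lo and lo′ and the rows
  -- u … u+j−1 have length ≥ kk, then lo may be replaced by lo′: both
  -- bounds are implied by the floor, and neither moves the row ends.
  cutSum-lo-irrelevant : ∀ lam j u lo lo′ kk m → lo ≤ kk → lo′ ≤ kk →
    (∀ i → u ≤ i → i < u + j → kk ≤ lam i) → cutSum lam u j lo kk m ≈ cutSum lam u j lo′ kk m
  cutSum-lo-irrelevant lam zero    u lo lo′ kk m _ _ _ = refl
  cutSum-lo-irrelevant lam (suc j) u lo lo′ kk m lo≤kk lo′≤kk long =
    sumN-cong B (λ c _ → only-resp (admissible? lo kk (lam u) m c) (admissible? lo′ kk (lam u) m c)
      (λ (_ , kk≤c , e , c≤m) → ≤-trans lo′≤kk kk≤c , kk≤c , move lo lo′ lo≤l lo′≤l e , c≤m)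
      (λ (_ , kk≤c , e , c≤m) → ≤-trans lo≤kk kk≤c , kk≤c , move lo′ lo lo′≤l lo≤l e , c≤m)
      (λ _ → *-congˡ (cutSum-lo-irrelevant lam j (suc u) lo lo′ kk c lo≤kk lo′≤kk
                        (λ i su≤i i<su+j → long i (≤-trans (n≤1+n u) su≤i) (≡.subst (i <_) (≡.sym (+-suc u j)) i<su+j)))))
    where
      kk≤l : kk ≤ lam u
      kk≤l = long u ≤-refl (≡.subst (u <_) (≡.sym (+-suc u j)) (s≤s (m≤m+n u j)))
      lo≤l  = ≤-trans lo≤kk kk≤l
      lo′≤l = ≤-trans lo′≤kk kk≤l
      move : ∀ a b {c l} → a ≤ l → b ≤ l → c ≤ a + (l ∸ a) → c ≤ b + (l ∸ b)
      move a b {c} a≤l b≤l h = ≡.subst (c ≤_) (≡.sym (m+[n∸m]≡n b≤l)) (≡.subst (c ≤_) (m+[n∸m]≡n a≤l) h)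

  -- Only the first cut is bounded by m directly, so m does not matter
  -- once it exceeds every admissible position of the first cut.
  cutSum-cap : ∀ lam n u lo kk m m′ → lo + (lam u ∸ lo) ≤ m → lo + (lam u ∸ lo) ≤ m′ →
    cutSum lam u n lo kk m ≈ cutSum lam u n lo kk m′
  cutSum-cap lam zero    u lo kk m m′ _ _ = refl
  cutSum-cap lam (suc n) u lo kk m m′ end≤m end≤m′ =
    sumN-cong B (λ c _ → only-resp (admissible? lo kk (lam u) m c) (admissible? lo kk (lam u) m′ c)
      (λ (a , b , e , _) → a , b , e , ≤-trans e end≤m′)
      (λ (a , b , e , _) → a , b , e , ≤-trans e end≤m)
      (λ _ → refl))

  -- If a row r among u … u+j−1 is shorter than the floor kk > lo, no cut
  -- of that row is admissible.
  cutSum-short-row : ∀ lam j u lo kk m r → u ≤ r → r < u + j → lo < kk → lam r < kk →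
    cutSum lam u j lo kk m ≈ 0#
  cutSum-short-row lam zero    u lo kk m r u≤r r<u lo<kk _ =
    ⊥-elim (≤⇒≯ u≤r (≡.subst (r <_) (ℕ.+-identityʳ u) r<u))
  cutSum-short-row lam (suc j) u lo kk m r u≤r r<u+j lo<kk short =
    sumN-zero B (λ c _ → summand c (u ℕ.≟ r))
    where
      end<kk : ∀ l → l < kk → lo + (l ∸ lo) < kk
      end<kk l l<kk with ≤-total lo l
      ... | inj₁ lo≤l = ≡.subst (_< kk) (≡.sym (m+[n∸m]≡n lo≤l)) l<kk
      ... | inj₂ l≤lo = ≡.subst (_< kk) (≡.sym (≡.trans (≡.cong (lo +_) (m≤n⇒m∸n≡0 l≤lo)) (ℕ.+-identityʳ lo))) lo<kk
      summand : ∀ c → Dec (u ≡ r) →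
        only (admissible? lo kk (lam u) m c) (segment u c (lam u) ⊛ cutSum lam (suc u) j lo kk c) ≈ 0#
      summand c (yes ≡.refl) = only-no (admissible? lo kk (lam u) m c)
        (λ (_ , kk≤c , e , _) → ≤⇒≯ (≤-trans kk≤c e) (end<kk (lam u) short))
      summand c (no u≢r) = only-zero (admissible? lo kk (lam u) m c)
        (λ _ → trans (*-congˡ (cutSum-short-row lam j (suc u) lo kk c r (≤∧≢⇒< u≤r u≢r)
                                 (≡.subst (r <_) (+-suc u j) r<u+j) lo<kk short)) (zeroʳ _))

  -- For the shape truncated at column k with lower bound k, the only
  -- admissible cut sequence is k, k, …, k, which has weight 1.
  cutSum-truncated-diagonal : ∀ lam n u k → k < B → cutSum (truncate k lam) u n k 0 k ≈ 1#
  cutSum-truncated-diagonal lam zero    u k k<B = refl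
  cutSum-truncated-diagonal lam (suc n) u k k<B = trans (sumN-single B k _ k<B others) at-k
    where
      at-k : only (admissible? k 0 (k ⊓ lam u) k k)
               (segment u k (k ⊓ lam u) ⊛ cutSum (truncate k lam) (suc u) n k 0 k) ≈ 1#
      at-k = trans (only-yes (admissible? k 0 (k ⊓ lam u) k k) (≤-refl , z≤n , m≤m+n k _ , ≤-refl))
               (trans (*-cong (segment-empty u k (k ⊓ lam u) (m⊓n≤m k (lam u)))
                              (cutSum-truncated-diagonal lam n (suc u) k k<B))
                      (*-identityˡ 1#))
      others : ∀ c → c < B → c ≢ k → only (admissible? k 0 (k ⊓ lam u) k c)
                 (segment u c (k ⊓ lam u) ⊛ cutSum (truncate k lam) (suc u) n k 0 c) ≈ 0#
      others c _ c≢k = only-no (admissible? k 0 (k ⊓ lam u) k c) (λ (k≤c , _ , _ , c≤k) → c≢k (≤-antisym c≤k k≤c))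

  -- Decomposition by the first row u+j whose cut is ≤ u+j.  Rows u …
  -- u+j−1 then have cuts ≥ u+j, and the remaining rows have cuts ≤ u+j,
  -- so they factor as in cutSum-factor.  tailSum is the contribution of
  -- rows k, k+1, … (r of them) when every cut there is ≤ k.
  tailSum : (ℕ → ℕ) → (lo k r : ℕ) → Carrier
  tailSum lam lo k r = block lam k k r ⊛ cutSum (truncate k lam) k r lo 0 k

  term : (ℕ → ℕ) → (u n lo m j : ℕ) → Carrier
  term lam u n lo m j = cutSum lam u j lo (u + j) m ⊛ tailSum lam lo (u + j) (n ∸ j)

  private
    split-first-cut : ∀ l u lo m c → u ≤ m → (X : Carrier) →
      only (admissible? lo 0 l m c) X ≈
      only (admissible? lo 0 l u c) X ⊕ only (admissible? lo 0 l m c ×-dec (suc u ≤? c)) X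
    split-first-cut l u lo m c u≤m X = by-cases (c ≤? u)
      where
        by-cases : Dec (c ≤ u) → only (admissible? lo 0 l m c) X ≈
          only (admissible? lo 0 l u c) X ⊕ only (admissible? lo 0 l m c ×-dec (suc u ≤? c)) X
        by-cases (yes c≤u) = sym (trans (+-congˡ (only-no (admissible? lo 0 l m c ×-dec (suc u ≤? c))
                                                    (λ (_ , u<c) → ≤⇒≯ c≤u u<c)))
                           (trans (+-identityʳ _)
                             (only-resp (admissible? lo 0 l u c) (admissible? lo 0 l m c)
                               (λ (a , b , e , _) → a , b , e , ≤-trans c≤u u≤m)
                               (λ (a , b , e , _) → a , b , e , c≤u) (λ _ → refl))))
        by-cases (no c≰u)  = sym (trans (+-congʳ (only-no (admissible? lo 0 l u c) (λ (_ , _ , _ , c≤u) → c≰u c≤u)))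
                           (trans (+-identityˡ _)
                             (only-resp (admissible? lo 0 l m c ×-dec (suc u ≤? c)) (admissible? lo 0 l m c)
                               proj₁ (λ a → a , ≰⇒> c≰u) (λ _ → refl))))

    -- j = 0: the first cut is ≤ u, and the whole sum factors
    first-cut-small : ∀ lam n u lo m →
      cutSum lam u (suc n) lo 0 u ≈ term lam u (suc n) lo m 0
    first-cut-small lam n u lo m =
      trans (cutSum-factor lam (suc n) u lo 0 u u ≤-refl)
        (trans (≡⇒≈ (λ k → tailSum lam lo k (suc n)) (≡.sym (ℕ.+-identityʳ u))) (sym (*-identityˡ _)))

    floor-too-high : ∀ lam u lo j c → suc u ≤ c → c < suc (u + j) →
      cutSum lam (suc u) j lo (suc (u + j)) c ≈ 0#
    floor-too-high lam u lo zero    c su≤c c<k rewrite ℕ.+-identityʳ u = ⊥-elim (≤⇒≯ su≤c c<k)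
    floor-too-high lam u lo (suc j) c su≤c c<k =
      cutSum-empty lam j (suc u) lo (suc (u + suc j)) c (λ d (_ , k≤d , _ , d≤c) → ≤⇒≯ (≤-trans k≤d d≤c) c<k)

    -- term j+1 of row u: a first cut c > u followed by term j of row u+1
    first-cut-large : ∀ lam n u lo m j →
      sumN (λ c → only (admissible? lo 0 (lam u) m c ×-dec (suc u ≤? c))
                       (segment u c (lam u) ⊛ term lam (suc u) n lo c j)) B
        ≈ term lam u (suc n) lo m (suc j)
    first-cut-large lam n u lo m j rewrite +-suc u j =
      trans (sumN-cong B (λ c _ → summand c (k ≤? c))) (sym (sumN-*ʳ B _ _))
      where
        k = suc (u + j)
        rest = tailSum lam lo k (n ∸ j)
        summand : ∀ c → Dec (k ≤ c) →
          only (admissible? lo 0 (lam u) m c ×-dec (suc u ≤? c)) (segment u c (lam u) ⊛ (cutSum lam (suc u) j lo k c ⊛ rest))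
            ≈ only (admissible? lo k (lam u) m c) (segment u c (lam u) ⊛ cutSum lam (suc u) j lo k c) ⊛ rest
        summand c (yes k≤c) =
          trans (only-resp (admissible? lo 0 (lam u) m c ×-dec (suc u ≤? c)) (admissible? lo k (lam u) m c)
                  (λ ((a , _ , e , c≤m) , _) → a , k≤c , e , c≤m)
                  (λ (a , _ , e , c≤m) → (a , z≤n , e , c≤m) , ≤-trans (s≤s (m≤m+n u j)) k≤c)
                  (λ _ → sym (*-assoc _ _ _)))
            (sym (only-*ʳ (admissible? lo k (lam u) m c) rest _))
        summand c (no k≰c) =
          trans (only-zero (admissible? lo 0 (lam u) m c ×-dec (suc u ≤? c))
                  (λ (_ , su≤c) → trans (*-congˡ (trans (*-congʳ (floor-too-high lam u lo j c su≤c (≰⇒> k≰c))) (zeroˡ _)))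
                                        (zeroʳ _)))
            (sym (trans (*-congʳ (only-no (admissible? lo k (lam u) m c) (λ (_ , k≤c , _) → k≰c k≤c))) (zeroˡ _)))

  cutSum-decompose : ∀ lam n u lo m → u ≤ m → cutSum lam u n lo 0 m ≈ sumN (term lam u n lo m) (suc n)
  cutSum-decompose lam zero    u lo m u≤m = sym (trans (+-identityʳ _) (trans (*-identityˡ _) (*-identityˡ _)))
  cutSum-decompose lam (suc n) u lo m u≤m = begin
      sumN (λ c → only (admissible? lo 0 l m c) (X c)) B
        ≈⟨ sumN-cong B (λ c _ → split-first-cut l u lo m c u≤m (X c)) ⟩
      sumN (λ c → only (admissible? lo 0 l u c) (X c) ⊕ only (large? c) (X c)) B
        ≈⟨ sumN-+ B _ _ ⟩
      cutSum lam u (suc n) lo 0 u ⊕ sumN (λ c → only (large? c) (X c)) B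
        ≈⟨ +-cong (first-cut-small lam n u lo m) large ⟩
      term lam u (suc n) lo m 0 ⊕ sumN (λ j → term lam u (suc n) lo m (suc j)) (suc n) ∎
    where
      l = lam u
      large? = λ c → admissible? lo 0 l m c ×-dec (suc u ≤? c)
      X : ℕ → Carrier
      X c = segment u c l ⊛ cutSum lam (suc u) n lo 0 c
      large : sumN (λ c → only (large? c) (X c)) B ≈ sumN (λ j → term lam u (suc n) lo m (suc j)) (suc n)
      large = begin
        sumN (λ c → only (large? c) (X c)) B
          ≈⟨ sumN-cong B (λ c _ → only-cong (large? c) (λ (_ , u<c) →
               trans (*-congˡ (cutSum-decompose lam n (suc u) lo c u<c)) (sumN-*ˡ (suc n) (segment u c l) (term lam (suc u) n lo c)))) ⟩
        sumN (λ c → only (large? c) (sumN (λ j → segment u c l ⊛ term lam (suc u) n lo c j) (suc n))) B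
          ≈⟨ sumN-cong B (λ c _ → only-sumN (large? c) (suc n) (λ j → segment u c l ⊛ term lam (suc u) n lo c j)) ⟩
        sumN (λ c → sumN (λ j → only (large? c) (segment u c l ⊛ term lam (suc u) n lo c j)) (suc n)) B
          ≈⟨ sumN-swap B (suc n) (λ c j → only (large? c) (segment u c l ⊛ term lam (suc u) n lo c j)) ⟩
        sumN (λ j → sumN (λ c → only (large? c) (segment u c l ⊛ term lam (suc u) n lo c j)) B) (suc n)
          ≈⟨ sumN-cong (suc n) (λ j _ → first-cut-large lam n u lo m j) ⟩
        sumN (λ j → term lam u (suc n) lo m (suc j)) (suc n) ∎


-- The entries P_{ab} and A_{kk} of Defs, defined by sums and products
-- over lists, expressed through cutSum and block: a subpartition μ of
-- the region λ(a+1,b+1) is the cut sequence c_r = b + μ_r.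
module ListSums {c ℓ : Level} (R : CommutativeRing c ℓ)
                (x : ℕ → ℕ → CommutativeRing.Carrier R) (B : ℕ) where
  open CommutativeRing R renaming (_+_ to _⊕_; _*_ to _⊛_)
  open WithRing R
  open FiniteSums R
  open CutSums R x B
  open import Relation.Binary.Reasoning.Setoid setoid

  sumL-cong : ∀ {A : Set} {f g : A → Carrier} xs → (∀ z → f z ≈ g z) → sumL (map f xs) ≈ sumL (map g xs)
  sumL-cong []       h = refl
  sumL-cong (z ∷ zs) h = +-cong (h z) (sumL-cong zs h)

  sumL-++ : ∀ {A : Set} (f : A → Carrier) xs ys → sumL (map f (xs ++ ys)) ≈ sumL (map f xs) ⊕ sumL (map f ys)
  sumL-++ f []       ys = sym (+-identityˡ _)
  sumL-++ f (z ∷ zs) ys = trans (+-congˡ (sumL-++ f zs ys)) (sym (+-assoc _ _ _))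

  sumL-concatMap : ∀ {A A′ : Set} (f : A′ → Carrier) (F : A → List A′) xs →
    sumL (map f (concatMap F xs)) ≈ sumL (map (λ z → sumL (map f (F z))) xs)
  sumL-concatMap f F []       = refl
  sumL-concatMap f F (z ∷ zs) = trans (sumL-++ f (F z) (concatMap F zs)) (+-congˡ (sumL-concatMap f F zs))

  sumL-map : ∀ {A A′ : Set} (f : A′ → Carrier) (g : A → A′) xs → sumL (map f (map g xs)) ≈ sumL (map (f ∘ g) xs)
  sumL-map f g []       = refl
  sumL-map f g (z ∷ zs) = +-congˡ (sumL-map f g zs)

  sumL-*ˡ : ∀ {A : Set} a (f : A → Carrier) xs → a ⊛ sumL (map f xs) ≈ sumL (map (λ z → a ⊛ f z) xs)
  sumL-*ˡ a f []       = zeroʳ a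
  sumL-*ˡ a f (z ∷ zs) = trans (distribˡ a _ _) (+-congˡ (sumL-*ˡ a f zs))

  sumL-applyUpTo : ∀ (f : ℕ → Carrier) n → sumL (map f (upTo n)) ≈ sumN f n
  sumL-applyUpTo f n = trans (reflexive (≡.cong sumL (map-upTo f n))) (go f n)
    where
      go : ∀ (g : ℕ → Carrier) n → sumL (applyUpTo g n) ≈ sumN g n
      go g zero    = refl
      go g (suc n) = +-congˡ (go (g ∘ suc) n)

  prodL-applyUpTo : ∀ (f : ℕ → Carrier) n → prodL (map f (upTo n)) ≈ prodN f n
  prodL-applyUpTo f n = trans (reflexive (≡.cong prodL (map-upTo f n))) (go f n)
    where
      go : ∀ (g : ℕ → Carrier) n → prodL (applyUpTo g n) ≈ prodN g n
      go g zero    = refl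
      go g (suc n) = *-congˡ (go (g ∘ suc) n)

  sumL-filter : ∀ (P : List ℕ → Bool) (g : List ℕ → Carrier) xs →
    sumL (map g (filterᵇ P xs)) ≈ sumL (map (λ z → when (P z) (g z)) xs)
  sumL-filter P g []       = refl
  sumL-filter P g (z ∷ zs) with P z
  ... | true  = +-congˡ (sumL-filter P g zs)
  ... | false = sym (trans (+-identityˡ _) (sym (sumL-filter P g zs)))

  when-sumL : ∀ {A : Set} b (f : A → Carrier) xs → when b (sumL (map f xs)) ≈ sumL (map (λ z → when b (f z)) xs)
  when-sumL true  f xs       = refl
  when-sumL false f []       = refl
  when-sumL false f (z ∷ zs) = sym (trans (+-congˡ (sym (when-sumL false f zs))) (+-identityˡ _))

  when-cong : ∀ b {u v} → u ≈ v → when b u ≈ when b v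
  when-cong true  e = e
  when-cong false e = refl

  when-∧ : ∀ b₁ b₂ r s → when (b₁ ∧ b₂) (r ⊛ s) ≈ when b₁ (r ⊛ when b₂ s)
  when-∧ true  true  r s = refl
  when-∧ true  false r s = sym (zeroʳ r)
  when-∧ false b₂    r s = refl

  ≤⇒not< : ∀ c m → c ≤ m → not (m <ᵇ c) ≡ true
  ≤⇒not< c m c≤m with m <ᵇ c in eq
  ... | false = ≡.refl
  ... | true  = ⊥-elim (≤⇒≯ c≤m (<ᵇ⇒< m c (≡.subst T (≡.sym eq) _)))

  ≰⇒not< : ∀ c m → ¬ c ≤ m → not (m <ᵇ c) ≡ false
  ≰⇒not< c m c≰m with m <ᵇ c in eq
  ... | true  = ≡.refl
  ... | false = ⊥-elim (≡.subst T eq (<⇒<ᵇ (≰⇒> c≰m)))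

  capped-decreasing : ℕ → List ℕ → Bool
  capped-decreasing m []      = true
  capped-decreasing m (c ∷ μ) = not (m <ᵇ c) ∧ decreasingᵇ (c ∷ μ)

  decreasing-cons : ∀ c μ → decreasingᵇ (c ∷ μ) ≡ capped-decreasing c μ
  decreasing-cons c []      = ≡.refl
  decreasing-cons c (d ∷ μ) = ≡.refl

  rowWeight : (a b k c n : ℕ) → Carrier
  rowWeight a b k c n = prodL (map (λ v → x (suc (a + k)) (suc (b + v))) (range c n))

  rowWeight-segment : ∀ a b k u c l → u ≡ a + k → rowWeight a b k c (l ∸ b) ≈ segment u (b + c) l
  rowWeight-segment a b k u c l ≡.refl = begin
    prodL (map g (map (c +_) (upTo ((l ∸ b) ∸ c))))   ≡⟨ ≡.cong prodL (map-∘ (upTo ((l ∸ b) ∸ c))) ⟨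
    prodL (map (g ∘ (c +_)) (upTo ((l ∸ b) ∸ c)))     ≈⟨ prodL-applyUpTo (g ∘ (c +_)) ((l ∸ b) ∸ c) ⟩
    prodN (g ∘ (c +_)) ((l ∸ b) ∸ c)                 ≈⟨ ≡⇒≈ (prodN (g ∘ (c +_))) (∸-+-assoc l b c) ⟩
    prodN (g ∘ (c +_)) (l ∸ (b + c))                 ≈⟨ prodN-cong (l ∸ (b + c)) (λ i →
                                                          ≡⇒≈ (λ v → x (suc (a + k)) (suc v)) (≡.sym (ℕ.+-assoc b c i))) ⟩
    segment (a + k) (b + c) l ∎
    where g = λ v → x (suc (a + k)) (suc (b + v))

  capped : (a b k : ℕ) → List ℕ → ℕ → Carrier
  capped a b k ν m = sumL (map (λ μ → when (capped-decreasing m μ) (skewProd x a b k ν μ)) (bounded ν))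

  sum-bounded-cons : ∀ a b k n ν (F : List ℕ → Carrier) (g : ℕ → Bool) →
    (∀ c μ → F (c ∷ μ) ≈ when (g c) (rowWeight a b k c n ⊛ when (capped-decreasing c μ) (skewProd x a b (suc k) ν μ))) →
    sumL (map F (bounded (n ∷ ν))) ≈ sumN (λ c → when (g c) (rowWeight a b k c n ⊛ capped a b (suc k) ν c)) (suc n)
  sum-bounded-cons a b k n ν F g split = begin
    sumL (map F (bounded (n ∷ ν)))
      ≈⟨ sumL-concatMap F (λ c → map (c ∷_) (bounded ν)) (upTo (suc n)) ⟩
    sumL (map (λ c → sumL (map F (map (c ∷_) (bounded ν)))) (upTo (suc n)))
      ≈⟨ sumL-cong (upTo (suc n)) first-row ⟩
    sumL (map (λ c → when (g c) (rowWeight a b k c n ⊛ capped a b (suc k) ν c)) (upTo (suc n)))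
      ≈⟨ sumL-applyUpTo _ (suc n) ⟩
    sumN (λ c → when (g c) (rowWeight a b k c n ⊛ capped a b (suc k) ν c)) (suc n) ∎
    where
      first-row : ∀ c → sumL (map F (map (c ∷_) (bounded ν))) ≈
                        when (g c) (rowWeight a b k c n ⊛ capped a b (suc k) ν c)
      first-row c = begin
        sumL (map F (map (c ∷_) (bounded ν)))
          ≈⟨ trans (sumL-map F (c ∷_) (bounded ν)) (sumL-cong (bounded ν) (split c)) ⟩
        sumL (map (λ μ → when (g c) (rowWeight a b k c n ⊛ when (capped-decreasing c μ) (skewProd x a b (suc k) ν μ))) (bounded ν))
          ≈⟨ when-sumL (g c) _ (bounded ν) ⟨
        when (g c) (sumL (map (λ μ → rowWeight a b k c n ⊛ when (capped-decreasing c μ) (skewProd x a b (suc k) ν μ)) (bounded ν)))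
          ≈⟨ when-cong (g c) (sumL-*ˡ _ _ (bounded ν)) ⟨
        when (g c) (rowWeight a b k c n ⊛ capped a b (suc k) ν c) ∎

  capped-split : ∀ a b k n ν m c μ →
    when (capped-decreasing m (c ∷ μ)) (skewProd x a b k (n ∷ ν) (c ∷ μ)) ≈
    when (not (m <ᵇ c)) (rowWeight a b k c n ⊛ when (capped-decreasing c μ) (skewProd x a b (suc k) ν μ))
  capped-split a b k n ν m c μ =
    trans (reflexive (≡.cong (λ d → when (not (m <ᵇ c) ∧ d) (rowWeight a b k c n ⊛ skewProd x a b (suc k) ν μ))
                             (decreasing-cons c μ)))
          (when-∧ (not (m <ᵇ c)) (capped-decreasing c μ) _ _)

  private
    sumN-window : ∀ (H : ℕ → Carrier) b w → b + w ≤ B → (∀ c → c < b → H c ≈ 0#) →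
      (∀ i → w ≤ i → H (b + i) ≈ 0#) → sumN (λ c → H (b + c)) w ≈ sumN H B
    sumN-window H b w b+w≤B below above = sym (begin
      sumN H B                           ≡⟨ ≡.cong (sumN H) (≡.sym (m+[n∸m]≡n (m+n≤o⇒m≤o b b+w≤B))) ⟩
      sumN H (b + (B ∸ b))               ≈⟨ sumN-drop b (B ∸ b) H below ⟩
      sumN (λ c → H (b + c)) (B ∸ b)     ≈⟨ sumN-truncate (B ∸ b) w (λ c → H (b + c)) w≤B∸b (λ i w≤i _ → above i w≤i) ⟩
      sumN (λ c → H (b + c)) w ∎)
      where
        w≤B∸b : w ≤ B ∸ b
        w≤B∸b = m+n≤o⇒m≤o∸n w (≡.subst (_≤ B) (ℕ.+-comm b w) b+w≤B)

  capped-cutSum : ∀ lam a b L (f : ℕ → ℕ) k u m → u ≡ a + k → (∀ i → f i ≡ lam (u + i) ∸ b) →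
    (∀ v → b + suc (lam v ∸ b) ≤ B) → capped a b k (applyUpTo f L) m ≈ cutSum lam u L b 0 (b + m)
  capped-cutSum lam a b zero    f k u m _  _  _      = +-identityʳ _
  capped-cutSum lam a b (suc L) f k u m eu hf fits =
    trans (sum-bounded-cons a b k (f 0) ν (λ μ → when (capped-decreasing m μ) (skewProd x a b k (f 0 ∷ ν) μ))
             (λ c → not (m <ᵇ c)) (capped-split a b k (f 0) ν m))
          (in-row (f 0) (≡.trans (hf 0) (≡.cong (λ z → lam z ∸ b) (ℕ.+-identityʳ u))))
    where
      ν = applyUpTo (f ∘ suc) L
      rest : ∀ c → capped a b (suc k) ν c ≈ cutSum lam (suc u) L b 0 (b + c)
      rest c = capped-cutSum lam a b L (f ∘ suc) (suc k) (suc u) c (≡.trans (≡.cong suc eu) (≡.sym (+-suc a k)))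
                 (λ i → ≡.trans (hf (suc i)) (≡.cong (λ z → lam z ∸ b) (+-suc u i))) fits
      H : ℕ → Carrier
      H d = only (admissible? b 0 (lam u) (b + m) d) (segment u d (lam u) ⊛ cutSum lam (suc u) L b 0 d)
      in-row : ∀ n → n ≡ lam u ∸ b →
        sumN (λ c → when (not (m <ᵇ c)) (rowWeight a b k c n ⊛ capped a b (suc k) ν c)) (suc n) ≈ cutSum lam u (suc L) b 0 (b + m)
      in-row n ≡.refl =
        trans (sumN-cong (suc n) (λ c c<sn → summand c (≤-pred c<sn)))
          (sumN-window H b (suc n) (fits u)
            (λ c c<b → only-no (admissible? b 0 (lam u) (b + m) c) (λ (b≤c , _) → ≤⇒≯ b≤c c<b))
            (λ i n<i → only-no (admissible? b 0 (lam u) (b + m) (b + i))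
                         (λ (_ , _ , e , _) → ≤⇒≯ (+-cancelˡ-≤ b _ _ e) n<i)))
        where
          summand : ∀ c → c ≤ n → when (not (m <ᵇ c)) (rowWeight a b k c n ⊛ capped a b (suc k) ν c) ≈ H (b + c)
          summand c c≤n with c ≤? m
          ... | yes c≤m = trans (reflexive (≡.cong (λ z → when z _) (≤⇒not< c m c≤m)))
                            (sym (trans (only-yes (admissible? b 0 (lam u) (b + m) (b + c))
                                           (m≤m+n b c , z≤n , +-monoʳ-≤ b c≤n , +-monoʳ-≤ b c≤m))
                                        (sym (*-cong (rowWeight-segment a b k u c (lam u) eu) (rest c)))))
          ... | no c≰m  = trans (reflexive (≡.cong (λ z → when z _) (≰⇒not< c m c≰m)))
                            (sym (only-no (admissible? b 0 (lam u) (b + m) (b + c))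
                                   (λ (_ , _ , _ , e) → c≰m (+-cancelˡ-≤ b _ _ e))))

  -- Every μ ∈ bounded (n ∷ ν) starts at most at n, so among the
  -- decreasing ones the cap n is no restriction.
  decreasing-capped : ∀ a b k n ν →
    sumL (map (λ μ → when (decreasingᵇ μ) (skewProd x a b k (n ∷ ν) μ)) (bounded (n ∷ ν))) ≈ capped a b k (n ∷ ν) n
  decreasing-capped a b k n ν = begin
    sumL (map (λ μ → when (decreasingᵇ μ) (skewProd x a b k (n ∷ ν) μ)) (bounded (n ∷ ν)))
      ≈⟨ sum-bounded-cons a b k n ν _ (λ _ → true)
           (λ c μ → trans (reflexive (≡.cong (λ d → when d (rowWeight a b k c n ⊛ skewProd x a b (suc k) ν μ))
                                             (decreasing-cons c μ)))
                          (when-∧ true (capped-decreasing c μ) _ _)) ⟩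
    sumN (λ c → rowWeight a b k c n ⊛ capped a b (suc k) ν c) (suc n)
      ≈⟨ sumN-cong (suc n) (λ c c<sn → reflexive (≡.cong (λ z → when z (rowWeight a b k c n ⊛ capped a b (suc k) ν c))
                                                          (≡.sym (≤⇒not< c n (≤-pred c<sn))))) ⟩
    sumN (λ c → when (not (n <ᵇ c)) (rowWeight a b k c n ⊛ capped a b (suc k) ν c)) (suc n)
      ≈⟨ sum-bounded-cons a b k n ν (λ μ → when (capped-decreasing n μ) (skewProd x a b k (n ∷ ν) μ))
           (λ c → not (n <ᵇ c)) (capped-split a b k n ν n) ⟨
    capped a b k (n ∷ ν) n ∎

  Pentry-cutSum : ∀ (p : List ℕ) a b → (∀ v → b + suc (row p v ∸ b) ≤ B) →
    Pentry p x a b ≈ cutSum (row p) a (length p ∸ a) b 0 B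
  Pentry-cutSum p a b fits = begin
    Pentry p x a b
      ≈⟨ sumL-filter decreasingᵇ (skewProd x a b 0 ν) (bounded ν) ⟩
    sumL (map (λ μ → when (decreasingᵇ μ) (skewProd x a b 0 ν μ)) (bounded ν))
      ≡⟨ ≡.cong (λ ν′ → sumL (map (λ μ → when (decreasingᵇ μ) (skewProd x a b 0 ν′ μ)) (bounded ν′)))
                (map-upTo f (length p ∸ a)) ⟩
    decreasing-sum (length p ∸ a)
      ≈⟨ decreasing-cutSum (length p ∸ a) ⟩
    cutSum (row p) a (length p ∸ a) b 0 B ∎
    where
      ν = regionRows p a b
      f : ℕ → ℕ
      f k = row p (a + k) ∸ b
      decreasing-sum : ℕ → Carrier
      decreasing-sum L =
        sumL (map (λ μ → when (decreasingᵇ μ) (skewProd x a b 0 (applyUpTo f L) μ)) (bounded (applyUpTo f L)))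
      decreasing-cutSum : ∀ L → decreasing-sum L ≈ cutSum (row p) a L b 0 B
      decreasing-cutSum zero    = +-identityʳ _
      decreasing-cutSum (suc L) = begin
        decreasing-sum (suc L)
          ≈⟨ decreasing-capped a b 0 (f 0) (applyUpTo (f ∘ suc) L) ⟩
        capped a b 0 (applyUpTo f (suc L)) (f 0)
          ≈⟨ capped-cutSum (row p) a b (suc L) f 0 a (f 0) (≡.sym (ℕ.+-identityʳ a)) (λ _ → ≡.refl) fits ⟩
        cutSum (row p) a (suc L) b 0 (b + f 0)
          ≈⟨ cutSum-cap (row p) (suc L) a b 0 (b + f 0) B
               (≡.subst (λ z → b + (row p z ∸ b) ≤ b + f 0) (ℕ.+-identityʳ a) ≤-refl)
               (<⇒≤ (≡.subst (_≤ B) (+-suc b _) (fits a))) ⟩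
        cutSum (row p) a (suc L) b 0 B ∎

  Aentry-block : ∀ (p : List ℕ) k → Aentry p x k k ≈ block (row p) k k (length p ∸ k)
  Aentry-block p k =
    trans (reflexive (≡.cong (λ ν → skewProd x k k 0 ν []) (map-upTo (λ i → row p (k + i) ∸ k) (length p ∸ k))))
      (rows (length p ∸ k) (λ i → row p (k + i) ∸ k) 0 k (≡.sym (ℕ.+-identityʳ k)) (λ _ → ≡.refl))
    where
      rows : ∀ L (f : ℕ → ℕ) j u → u ≡ k + j → (∀ i → f i ≡ row p (u + i) ∸ k) →
        skewProd x k k j (applyUpTo f L) [] ≈ block (row p) k u L
      rows zero    f j u eu hf = refl
      rows (suc L) f j u eu hf =
        *-cong (first (f 0) (≡.trans (hf 0) (≡.cong (λ z → row p z ∸ k) (ℕ.+-identityʳ u))))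
          (rows L (f ∘ suc) (suc j) (suc u) (≡.trans (≡.cong suc eu) (≡.sym (+-suc k j)))
            (λ i → ≡.trans (hf (suc i)) (≡.cong (λ z → row p z ∸ k) (+-suc u i))))
        where
          first : ∀ n → n ≡ row p u ∸ k → rowWeight k k j 0 n ≈ segment u k (row p u)
          first n ≡.refl = trans (rowWeight-segment k k j u 0 (row p u) eu)
                             (≡⇒≈ (λ z → segment u z (row p u)) (ℕ.+-identityʳ k))


-- The LDU factorisation M(1,1) = U · diag(A_{kk}) · L, with U upper and
-- L lower unitriangular.  Indices are 0-based: entry (a, b) of M(1,1) is
-- P_{a+1,b+1}, and a, b, k range over 0 … ρ.
module Factorisation {c ℓ : Level} (R : CommutativeRing c ℓ) (p : List ℕ) (isP : IsPartition p)
                     (x : ℕ → ℕ → CommutativeRing.Carrier R) where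
  open CommutativeRing R renaming (_+_ to _⊕_; _*_ to _⊛_)
  open WithRing R
  open FiniteSums R
  open Matrices R
  open Partitions.Rank p isP
  open import Relation.Binary.Reasoning.Setoid setoid

  lam : ℕ → ℕ
  lam = row p

  ρ : ℕ
  ρ = rank p

  -- a column bound beyond every cut that occurs
  B : ℕ
  B = suc (ρ + lam 0)

  open CutSums R x B
  open ListSums R x B

  fits : ∀ b → b ≤ ρ → ∀ v → b + suc (lam v ∸ b) ≤ B
  fits b b≤ρ v = ≡.subst (_≤ B) (≡.sym (+-suc b _))
    (s≤s (+-mono-≤ b≤ρ (≤-trans (m∸n≤m (lam v) b) (Partitions.row-antitone p (proj₁ isP) z≤n))))

  -- U_{ak}: cuts of rows a … k−1, all at columns ≥ k  (zero unless a ≤ k)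
  Ucoef : ℕ → ℕ → Carrier
  Ucoef a k = only (a ≤? k) (cutSum lam a (k ∸ a) k k B)

  -- L_{kb}: cuts ≥ b of rows k, k+1, … of λ truncated at column k
  -- (zero unless b ≤ k)
  Lcoef : ℕ → ℕ → Carrier
  Lcoef k b = only (b ≤? k) (cutSum (truncate k lam) k (length p ∸ k) b 0 k)

  Acoef : ℕ → Carrier
  Acoef k = Aentry p x k k

  UDL-term : ℕ → ℕ → ℕ → Carrier
  UDL-term a b k = Ucoef a k ⊛ (Acoef k ⊛ Lcoef k b)

  private
    last-factor-zero : ∀ {a b c} → c ≈ 0# → a ⊛ (b ⊛ c) ≈ 0#
    last-factor-zero c≈0 = trans (*-congˡ (trans (*-congˡ c≈0) (zeroʳ _))) (zeroʳ _)

    term-within-rank : ∀ a b j → b ≤ ρ → a + j ≤ ρ →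
      term lam a (length p ∸ a) b B j ≈ UDL-term a b (a + j)
    term-within-rank a b j b≤ρ k≤ρ = by-cases (b ≤? a + j)
      where
        k = a + j
        rows-left : length p ∸ a ∸ j ≡ length p ∸ k
        rows-left = ∸-+-assoc (length p) a j
        by-cases : Dec (b ≤ k) → term lam a (length p ∸ a) b B j ≈ UDL-term a b k
        by-cases (yes b≤k) = *-cong U-factor (*-cong A-factor L-factor)
          where
            U-factor : cutSum lam a j b k B ≈ Ucoef a k
            U-factor = sym (trans (only-yes (a ≤? k) (m≤m+n a j))
                         (trans (≡⇒≈ (λ n → cutSum lam a n k k B) (m+n∸m≡n a j))
                           (cutSum-lo-irrelevant lam j a k b k B ≤-refl b≤k
                             (λ i _ i<k → square-in k k≤ρ i i<k))))
            A-factor : block lam k k (length p ∸ a ∸ j) ≈ Acoef k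
            A-factor = trans (≡⇒≈ (block lam k k) rows-left) (sym (Aentry-block p k))
            L-factor : cutSum (truncate k lam) k (length p ∸ a ∸ j) b 0 k ≈ Lcoef k b
            L-factor = trans (≡⇒≈ (λ n → cutSum (truncate k lam) k n b 0 k) rows-left)
                         (sym (only-yes (b ≤? k) b≤k))
        by-cases (no b≰k) = trans (last-factor-zero (no-cuts (length p ∸ a ∸ j) rows-left))
                                  (sym (last-factor-zero (only-no (b ≤? k) b≰k)))
          where
            k<ℓ : k < length p
            k<ℓ = <-≤-trans (≰⇒> b≰k) (≤-trans b≤ρ rank≤length)
            -- cuts ≥ b > k are impossible in the shape truncated at k
            no-cuts : ∀ n → n ≡ length p ∸ k → cutSum (truncate k lam) k n b 0 k ≈ 0#
            no-cuts zero    e = ⊥-elim (≤⇒≯ (m∸n≡0⇒m≤n (≡.sym e)) k<ℓ)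
            no-cuts (suc n) e = cutSum-empty (truncate k lam) n k b 0 k
                                  (λ c (b≤c , _ , _ , c≤k) → ≤⇒≯ (≤-trans b≤c c≤k) (≰⇒> b≰k))

    -- beyond the rank, row ρ is too short to carry a cut ≥ a+j
    term-beyond-rank : ∀ a b j → a ≤ ρ → b ≤ ρ → ρ < a + j → term lam a (length p ∸ a) b B j ≈ 0#
    term-beyond-rank a b j a≤ρ b≤ρ ρ<k =
      trans (*-congʳ (cutSum-short-row lam j a b (a + j) B ρ a≤ρ ρ<k (≤-<-trans b≤ρ ρ<k)
                        (≤-<-trans diagonal-out ρ<k)))
            (zeroˡ _)

  Pentry-UDL : ∀ a b → a ≤ ρ → b ≤ ρ → Pentry p x a b ≈ sumN (UDL-term a b) (suc ρ)
  Pentry-UDL a b a≤ρ b≤ρ = begin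
    Pentry p x a b
      ≈⟨ Pentry-cutSum p a b (fits b b≤ρ) ⟩
    cutSum lam a n b 0 B
      ≈⟨ cutSum-decompose lam n a b B a≤B ⟩
    sumN (term lam a n b B) (suc n)
      ≈⟨ sumN-truncate (suc n) (suc t) _ (s≤s (∸-monoˡ-≤ a rank≤length))
           (λ j t<j _ → term-beyond-rank a b j a≤ρ b≤ρ (beyond j t<j)) ⟩
    sumN (term lam a n b B) (suc t)
      ≈⟨ sumN-cong (suc t) (λ j j<st → term-within-rank a b j b≤ρ (within j (≤-pred j<st))) ⟩
    sumN (λ j → UDL-term a b (a + j)) (suc t)
      ≈⟨ sumN-drop a (suc t) (UDL-term a b) (λ k k<a → trans (*-congʳ (U-below k k<a)) (zeroˡ _)) ⟨
    sumN (UDL-term a b) (a + suc t)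
      ≡⟨ ≡.cong (sumN (UDL-term a b)) a+st≡sρ ⟩
    sumN (UDL-term a b) (suc ρ) ∎
    where
      n = length p ∸ a
      t = ρ ∸ a
      a≤B : a ≤ B
      a≤B = m≤n⇒m≤1+n (≤-trans a≤ρ (m≤m+n ρ _))
      a+st≡sρ : a + suc t ≡ suc ρ
      a+st≡sρ = ≡.trans (+-suc a t) (≡.cong suc (m+[n∸m]≡n a≤ρ))
      within : ∀ j → j ≤ t → a + j ≤ ρ
      within j j≤t = ≡.subst (a + j ≤_) (m+[n∸m]≡n a≤ρ) (+-monoʳ-≤ a j≤t)
      beyond : ∀ j → suc t ≤ j → ρ < a + j
      beyond j st≤j = ≡.subst (_≤ a + j) a+st≡sρ (+-monoʳ-≤ a st≤j)
      U-below : ∀ k → k < a → Ucoef a k ≈ 0#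
      U-below k k<a = only-no (a ≤? k) (λ a≤k → ≤⇒≯ a≤k k<a)

  N : ℕ
  N = suc ρ

  U : Matrix N
  U i j = Ucoef (toℕ i) (toℕ j)

  L : Matrix N
  L i j = Lcoef (toℕ i) (toℕ j)

  d : Fin N → Carrier
  d i = Acoef (toℕ i)

  private
    toℕ≤ρ : (i : Fin N) → toℕ i ≤ ρ
    toℕ≤ρ i = ≤-pred (toℕ<n i)

  U-unitriangular : UpperUnitriangular U
  U-unitriangular =
      (λ i → trans (only-yes (toℕ i ≤? toℕ i) ≤-refl)
                   (≡⇒≈ (λ n → cutSum lam (toℕ i) n (toℕ i) (toℕ i) B) (n∸n≡0 (toℕ i))))
    , (λ i j j<i → only-no (toℕ i ≤? toℕ j) (λ i≤j → ≤⇒≯ i≤j j<i))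

  L-unitriangular : LowerUnitriangular L
  L-unitriangular =
      (λ i → trans (only-yes (toℕ i ≤? toℕ i) ≤-refl)
                   (cutSum-truncated-diagonal lam (length p ∸ toℕ i) (toℕ i) (toℕ i)
                     (s≤s (≤-trans (toℕ≤ρ i) (m≤m+n ρ _)))))
    , (λ i j i<j → only-no (toℕ j ≤? toℕ i) (λ j≤i → ≤⇒≯ j≤i i<j))

  M11≋UDL : M11 p x ≋ (U ⊗ (diag d ⊗ L))
  M11≋UDL i j = begin
    Pentry p x (toℕ i) (toℕ j)                 ≈⟨ Pentry-UDL (toℕ i) (toℕ j) (toℕ≤ρ i) (toℕ≤ρ j) ⟩
    sumN (UDL-term (toℕ i) (toℕ j)) N          ≈⟨ sumFin-toℕ N (UDL-term (toℕ i) (toℕ j)) ⟨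
    sumFin N (λ k → U i k ⊛ (d k ⊛ L k j))     ≈⟨ sumFin-cong N (λ k → *-congˡ {x = U i k} (diag-⊗ d L k j)) ⟨
    sumFin N (λ k → U i k ⊛ (diag d ⊗ L) k j) ∎


theorem1 : ∀ {c ℓ} (R : CommutativeRing c ℓ) (lam : List ℕ) → IsPartition lam →
    (x : ℕ → ℕ → CommutativeRing.Carrier R) →
    let open WithRing R in
    Σ (Matrix (suc (rank lam))) λ P → Σ (Matrix (suc (rank lam))) λ Q →
    UpperUnitriangular P × LowerUnitriangular Q ×
    ((P ⊗ M11 lam x) ⊗ Q) ≋ diag (λ i → Aentry lam x (toℕ i) (toℕ i))
theorem1 R lam isP x = diagonalise (M11 lam x) U L d U-unitriangular L-unitriangular M11≋UDL
  where
    open WithRing R using (M11)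
    open Matrices R using (diagonalise)
    open Factorisation R lam isP x using (U; L; d; U-unitriangular; L-unitriangular; M11≋UDL)
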